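{- Let $G$ be a graph and $H$ a $c$-degenerate graph, both on $n$ vertices. Let $d_1^{(G)}\geq d_2^{(G)}\geq\dotsb\geq d_n^{(G)}$ be the degree sequence of $G$ and $d_1^{(H)}\geq d_2^{(H)}\geq\dotsb\geq d_n^{(H)}$ the degree sequence of $H$. If \[ \sum_{i=1}^{\Delta(G)} d_i^{(H)}+\sum_{j=1}^{c} d_j^{(G)}<n, \] then $G$ and $H$ pack.
   Context: All graphs are finite and simple. $\Delta(G)$ is the maximum degree of $G$. A graph $H$ is $c$-degenerate if every nonempty subgraph of $H$ has a vertex of degree at most $c$. Two graphs $G$ and $H$ on $n$ vertices pack if there is a bijection $f:V(G)\to V(H)$ such that for every edge $uv\in E(G)$, $f(u)f(v)\notin E(H)$. -}

module Defs where

open import Data.Bool using (Bool; true; false; if_then_else_)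
open import Data.Nat using (ℕ; _≤_; _⊔_)
open import Data.Nat.Properties using (≤-decTotalOrder)
open import Data.Fin using (Fin)
open import Data.Nat.ListAction using (sum)
open import Data.List using (List; map; take; reverse; foldr; allFin)
open import Data.Product using (Σ; _×_; ∃)
open import Relation.Binary.PropositionalEquality using (_≡_)
open import Function.Bundles using (_⤖_; Bijection)
import Data.List.Sort

record Graph (n : ℕ) : Set where
  field
    adj     : Fin n → Fin n → Bool
    adj-sym : ∀ u v → adj u v ≡ adj v u
    irrefl  : ∀ v → adj v v ≡ false
open Graph public

countNbrs : {n : ℕ} → (Fin n → Fin n → Bool) → Fin n → ℕ
countNbrs {n} R v = sum (map (λ w → if R v w then 1 else 0) (allFin n))

deg : {n : ℕ} → Graph n → Fin n → ℕ
deg G v = countNbrs (adj G) v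

degrees : {n : ℕ} → Graph n → List ℕ
degrees {n} G = map (deg G) (allFin n)

open Data.List.Sort ≤-decTotalOrder using (sort)

degSeq : {n : ℕ} → Graph n → List ℕ
degSeq G = reverse (sort (degrees G))

sumTop : {n : ℕ} → ℕ → Graph n → ℕ
sumTop k G = sum (take k (degSeq G))

maxDeg : {n : ℕ} → Graph n → ℕ
maxDeg G = foldr _⊔_ 0 (degrees G)

record Subgraph {n : ℕ} (G : Graph n) : Set where
  field
    inS    : Fin n → Bool
    edge   : Fin n → Fin n → Bool
    e-sym  : ∀ u v → edge u v ≡ edge v u
    e-sub  : ∀ u v → edge u v ≡ true → adj G u v ≡ true
    e-inS  : ∀ u v → edge u v ≡ true → inS u ≡ true
open Subgraph public

Degenerate : {n : ℕ} → ℕ → Graph n → Set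
Degenerate {n} c H =
  (K : Subgraph H) → ∃ (λ (v : Fin n) → inS K v ≡ true) →
  ∃ (λ (v : Fin n) → inS K v ≡ true × countNbrs (edge K) v ≤ c)

Pack : {n : ℕ} → Graph n → Graph n → Set
Pack {n} G H =
  Σ (Fin n ⤖ Fin n) (λ f →
    ∀ u v → adj G u v ≡ true →
      adj H (Bijection.to f u) (Bijection.to f v) ≡ false)

-- Induct on a vertex set S of H, keeping a bijection σ that packs G with the induced subgraph H[S].
-- To add a vertex x, choose it of degree ≤ c in H[S] (degeneracy), take σ for S − x and put
-- u = σ⁻¹(x). Exchanging u with another vertex w of G only creates conflicts at u and at w.
-- Summed over all w, the conflicts at u are at most the total G-degree of the ≤ c preimages of
-- the neighbours of x, hence ≤ d₁(G) + … + d_c(G); the conflicts at w are at most the total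
-- H-degree of the images of the ≤ Δ(G) neighbours of u, hence ≤ d₁(H) + … + d_Δ(G)(H).
-- The hypothesis makes the total less than n, so some w creates no conflict.
module Submission where

open import Defs
open import Data.Bool using (Bool; true; false; if_then_else_; _∧_; not)
open import Data.Bool.Properties as Bool using (∧-comm; ∧-conicalˡ; ∧-conicalʳ)
open import Data.Empty using (⊥-elim)
open import Data.Fin using (Fin; zero; suc)
open import Data.Fin.Properties using (_≟_; any?)
open import Data.Fin.Permutation
  using (Permutation′; _⟨$⟩ʳ_; _⟨$⟩ˡ_; inverseʳ; inverseˡ; transpose; _∘ₚ_)
  renaming (id to idₚ; flip to _⁻¹)
import Data.Fin.Permutation.Components as PC
open import Data.List using (List; []; _∷_; map; tabulate; allFin; take; reverse; foldr)
open import Data.List.Properties using (map-tabulate; map-∘; unfold-reverse)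
open import Data.List.Relation.Unary.All as All using (All; []; _∷_)
open import Data.List.Relation.Unary.AllPairs using (AllPairs; []; _∷_)
open import Data.List.Relation.Unary.AllPairs.Properties using (++⁺)
open import Data.List.Relation.Unary.Linked.Properties using (Linked⇒AllPairs)
open import Data.List.Relation.Binary.Permutation.Propositional using (↭-sym; ↭-trans)
open import Data.List.Relation.Binary.Permutation.Propositional.Properties
  using (All-resp-↭; ↭-reverse; map⁺)
open import Data.Nat using (ℕ; zero; suc; _+_; _*_; _∸_; _≤_; _<_; _≥_; z≤n; s≤s; _⊔_)
open import Data.Nat.Induction using (<-wellFounded)
open import Data.Nat.ListAction using (sum)
open import Data.Nat.ListAction.Properties using (sum-↭)
open import Data.Nat.Properties
  using ( ≤-refl; ≤-reflexive; ≤-trans; ≤-pred; ≤-decTotalOrder; module ≤-Reasoning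
        ; +-comm; +-identityʳ; *-identityˡ; *-zeroʳ; +-*-semiring; +-commutativeSemigroup
        ; +-mono-≤; +-monoˡ-≤; +-mono-<-≤; +-mono-≤-<; *-monoˡ-≤; m≤n+m
        ; m+n≡0⇒m≡0; m+n≡0⇒n≡0; m≤m⊔n; m≤n⊔m
        ; n∸n≡0; m≤n⇒m∸n≡0; m+[n∸m]≡n; m≤n+m∸n )
open import Data.Product using (∃; _,_)
open import Algebra.Properties.CommutativeSemigroup +-commutativeSemigroup
  using () renaming (interchange to +-interchange)
open import Algebra.Properties.Semiring.Sum +-*-semiring
  using (sum-cong-≗; ∑-comm; ∑-distrib-+; sum-permute; *-distribˡ-sum; *-distribʳ-sum)
  renaming (sum to ∑)
open import Data.List.Sort ≤-decTotalOrder using (sort; sort-↗; sort-↭)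
open import Function using (_∘_; id; flip)
open import Function.Properties.Inverse using (↔⇒⤖)
open import Induction.WellFounded using (module All)
open import Relation.Binary using (Rel)
import Relation.Binary.Construct.On as On
open import Relation.Binary.PropositionalEquality
open import Relation.Nullary using (Dec; does; yes; no)
open import Relation.Nullary.Decidable using (dec-true; dec-false)

⟦_⟧ : Bool → ℕ
⟦ b ⟧ = if b then 1 else 0

⟦∧⟧ : ∀ a b → ⟦ a ∧ b ⟧ ≡ ⟦ a ⟧ * ⟦ b ⟧
⟦∧⟧ false b = refl
⟦∧⟧ true  b = sym (+-identityʳ ⟦ b ⟧)

⟦∧⟧-≤ˡ : ∀ a b → ⟦ a ∧ b ⟧ ≤ ⟦ a ⟧
⟦∧⟧-≤ˡ false b     = z≤n
⟦∧⟧-≤ˡ true  false = z≤n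
⟦∧⟧-≤ˡ true  true  = ≤-refl

⟦∧⟧-≤ʳ : ∀ a b → ⟦ a ∧ b ⟧ ≤ ⟦ b ⟧
⟦∧⟧-≤ʳ false b = z≤n
⟦∧⟧-≤ʳ true  b = ≤-refl

⟦⟧≡0⇒≡false : ∀ {b} → ⟦ b ⟧ ≡ 0 → b ≡ false
⟦⟧≡0⇒≡false {false} _ = refl

⟦⟧*-monoʳ-≤ : ∀ {b x y} → (b ≡ true → x ≤ y) → ⟦ b ⟧ * x ≤ ⟦ b ⟧ * y
⟦⟧*-monoʳ-≤ {false} _   = z≤n
⟦⟧*-monoʳ-≤ {true}  x≤y = +-monoˡ-≤ 0 (x≤y refl)

∧≡false⇒≡falseʳ : ∀ {a b} → a ≡ true → (a ∧ b) ≡ false → b ≡ false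
∧≡false⇒≡falseʳ refl = id

∧≡false⇒≡falseˡ : ∀ {a b} → b ≡ true → (a ∧ b) ≡ false → a ≡ false
∧≡false⇒≡falseˡ {a} {b} b≡true a∧b≡false = ∧≡false⇒≡falseʳ b≡true (trans (∧-comm b a) a∧b≡false)

sum-tabulate : ∀ {n} (f : Fin n → ℕ) → sum (tabulate f) ≡ ∑ f
sum-tabulate {zero}  f = refl
sum-tabulate {suc n} f = cong (f zero +_) (sum-tabulate (f ∘ suc))

sum-map-allFin : ∀ {n} (f : Fin n → ℕ) → sum (map f (allFin n)) ≡ ∑ f
sum-map-allFin f = trans (cong sum (map-tabulate id f)) (sum-tabulate f)

∑-mono-≤ : ∀ {n} {f g : Fin n → ℕ} → (∀ i → f i ≤ g i) → ∑ f ≤ ∑ g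
∑-mono-≤ {zero}  f≤g = z≤n
∑-mono-≤ {suc n} f≤g = +-mono-≤ (f≤g zero) (∑-mono-≤ (f≤g ∘ suc))

∑-mono-< : ∀ {n} {f g : Fin n → ℕ} → (∀ i → f i ≤ g i) → ∀ j → f j < g j → ∑ f < ∑ g
∑-mono-< f≤g zero    fj<gj = +-mono-<-≤ fj<gj (∑-mono-≤ (f≤g ∘ suc))
∑-mono-< f≤g (suc j) fj<gj = +-mono-≤-< (f≤g zero) (∑-mono-< (f≤g ∘ suc) j fj<gj)

∑≡0⇒≡0 : ∀ {n} (f : Fin n → ℕ) → ∑ f ≡ 0 → ∀ i → f i ≡ 0
∑≡0⇒≡0 f ∑f≡0 zero    = m+n≡0⇒m≡0 (f zero) ∑f≡0
∑≡0⇒≡0 f ∑f≡0 (suc i) = ∑≡0⇒≡0 (f ∘ suc) (m+n≡0⇒n≡0 (f zero) ∑f≡0) i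

∑<n⇒∃≡0 : ∀ {n} (f : Fin n → ℕ) → ∑ f < n → ∃ λ i → f i ≡ 0
∑<n⇒∃≡0 {suc n} f ∑f<n with f zero in f0≡
... | zero  = zero , f0≡
... | suc m with ∑<n⇒∃≡0 (f ∘ suc) (≤-trans (s≤s (m≤n+m _ m)) (≤-pred ∑f<n))
...   | i , fi≡0 = suc i , fi≡0

∑-comm-⟦∧⟧ : ∀ {m n} (p : Fin m → Bool) (q : Fin m → Fin n → Bool) →
  ∑ (λ w → ∑ (λ a → ⟦ p a ∧ q a w ⟧)) ≡ ∑ (λ a → ⟦ p a ⟧ * ∑ (λ w → ⟦ q a w ⟧))
∑-comm-⟦∧⟧ p q = begin
  ∑ (λ w → ∑ (λ a → ⟦ p a ∧ q a w ⟧))      ≡⟨ sym (∑-comm (λ a w → ⟦ p a ∧ q a w ⟧)) ⟩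
  ∑ (λ a → ∑ (λ w → ⟦ p a ∧ q a w ⟧))      ≡⟨ sum-cong-≗ (λ a → sum-cong-≗ (λ w → ⟦∧⟧ (p a) (q a w))) ⟩
  ∑ (λ a → ∑ (λ w → ⟦ p a ⟧ * ⟦ q a w ⟧))  ≡⟨ sum-cong-≗ (λ a → sym (*-distribˡ-sum ⟦ p a ⟧ (λ w → ⟦ q a w ⟧))) ⟩
  ∑ (λ a → ⟦ p a ⟧ * ∑ (λ w → ⟦ q a w ⟧))  ∎
  where open ≡-Reasoning

≤-foldr-⊔-tabulate : ∀ {n} (f : Fin n → ℕ) i → f i ≤ foldr _⊔_ 0 (tabulate f)
≤-foldr-⊔-tabulate f zero    = m≤m⊔n (f zero) _
≤-foldr-⊔-tabulate f (suc i) = ≤-trans (≤-foldr-⊔-tabulate (f ∘ suc) i) (m≤n⊔m (f zero) _)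

AllPairs-reverse⁺ : ∀ {a ℓ} {A : Set a} {R : Rel A ℓ} {xs : List A} →
                    AllPairs R xs → AllPairs (flip R) (reverse xs)
AllPairs-reverse⁺ {xs = []}     []         = []
AllPairs-reverse⁺ {xs = x ∷ xs} (Rx ∷ Rxs) rewrite unfold-reverse x xs =
  ++⁺ (AllPairs-reverse⁺ Rxs) ([] ∷ [])
      (All.map (_∷ []) (All-resp-↭ (↭-sym (↭-reverse xs)) Rx))

kth : ℕ → List ℕ → ℕ
kth k       []      = 0
kth zero    (d ∷ D) = d
kth (suc k) (d ∷ D) = kth k D

kth-≤ : ∀ {d} k {D} → All (_≤ d) D → kth k D ≤ d
kth-≤ k       []       = z≤n
kth-≤ zero    (p ∷ _)  = p
kth-≤ (suc k) (_ ∷ ps) = kth-≤ k ps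

sum-map-∸-≡0 : ∀ {t D} → All (_≤ t) D → sum (map (_∸ t) D) ≡ 0
sum-map-∸-≡0 []                         = refl
sum-map-∸-≡0 (d≤t ∷ ps) rewrite m≤n⇒m∸n≡0 d≤t = sum-map-∸-≡0 ps

-- In a non-increasing list D with t = kth k D, each of the first k entries is at least t
-- and every later entry is at most t.
sum-take-descending : ∀ k {D} → AllPairs _≥_ D →
                      k * kth k D + sum (map (_∸ kth k D) D) ≤ sum (take k D)
sum-take-descending zero    {[]}    _ = z≤n
sum-take-descending (suc k) {[]}    _ = ≤-reflexive (cong (_+ 0) (*-zeroʳ k))
sum-take-descending zero    {d ∷ D} (D≤d ∷ _) rewrite n∸n≡0 d | sum-map-∸-≡0 D≤d = z≤n
sum-take-descending (suc k) {d ∷ D} (D≤d ∷ desc) = begin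
  (t + k * t) + ((d ∸ t) + sum (map (_∸ t) D))  ≡⟨ +-interchange t (k * t) (d ∸ t) _ ⟩
  (t + (d ∸ t)) + (k * t + sum (map (_∸ t) D))  ≤⟨ +-mono-≤ (≤-reflexive (m+[n∸m]≡n (kth-≤ k D≤d)))
                                                             (sum-take-descending k desc) ⟩
  d + sum (take k D)                            ∎
  where
  open ≤-Reasoning
  t = kth k D

-- Threshold argument: for t the k-th largest value, ⟦ s ⟧ * d ≤ ⟦ s ⟧ * t + (d ∸ t).
∑-selected≤sum-largest : ∀ {n} (d : Fin n → ℕ) (sel : Fin n → Bool) {k} → ∑ (⟦_⟧ ∘ sel) ≤ k →
  ∑ (λ v → ⟦ sel v ⟧ * d v) ≤ sum (take k (reverse (sort (map d (allFin n)))))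
∑-selected≤sum-largest {n} d sel {k} |sel|≤k = begin
  ∑ (λ v → ⟦ sel v ⟧ * d v)                    ≤⟨ ∑-mono-≤ (λ v → split (sel v) (d v)) ⟩
  ∑ (λ v → ⟦ sel v ⟧ * t + (d v ∸ t))           ≡⟨ ∑-distrib-+ (λ v → ⟦ sel v ⟧ * t) (λ v → d v ∸ t) ⟩
  ∑ (λ v → ⟦ sel v ⟧ * t) + ∑ (λ v → d v ∸ t)  ≡⟨ cong₂ _+_ (sym (*-distribʳ-sum t (⟦_⟧ ∘ sel))) reorder ⟩
  ∑ (⟦_⟧ ∘ sel) * t + sum (map (_∸ t) D)        ≤⟨ +-monoˡ-≤ _ (*-monoˡ-≤ t |sel|≤k) ⟩
  k * t + sum (map (_∸ t) D)                    ≤⟨ sum-take-descending k descending ⟩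
  sum (take k D)                                ∎
  where
  open ≤-Reasoning
  L = map d (allFin n)
  D = reverse (sort L)
  t = kth k D
  descending : AllPairs _≥_ D
  descending = AllPairs-reverse⁺ (Linked⇒AllPairs ≤-trans (sort-↗ L))
  split : ∀ s x → ⟦ s ⟧ * x ≤ ⟦ s ⟧ * t + (x ∸ t)
  split false x = z≤n
  split true  x rewrite *-identityˡ x | *-identityˡ t = m≤n+m∸n x t
  reorder : ∑ (λ v → d v ∸ t) ≡ sum (map (_∸ t) D)
  reorder = begin-equality
    ∑ (λ v → d v ∸ t)                  ≡⟨ sum-map-allFin ((_∸ t) ∘ d) ⟨
    sum (map ((_∸ t) ∘ d) (allFin n))  ≡⟨ cong sum (map-∘ (allFin n)) ⟩
    sum (map (_∸ t) L)                 ≡⟨ sum-↭ (map⁺ (_∸ t) (↭-sym (↭-trans (↭-reverse (sort L)) (sort-↭ L)))) ⟩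
    sum (map (_∸ t) D)                 ∎

transpose-applyˡ : ∀ {n} (i j : Fin n) → PC.transpose i j i ≡ j
transpose-applyˡ i j rewrite dec-true (i ≟ i) refl = refl

transpose-applyʳ : ∀ {n} (i j : Fin n) → PC.transpose i j j ≡ i
transpose-applyʳ i j with j ≟ i
... | yes j≡i = j≡i
... | no  _   rewrite dec-true (j ≟ j) refl = refl

transpose-other : ∀ {n} {i j k : Fin n} → k ≢ i → k ≢ j → PC.transpose i j k ≡ k
transpose-other {i = i} {j} {k} k≢i k≢j rewrite dec-false (k ≟ i) k≢i | dec-false (k ≟ j) k≢j = refl

transpose-self : ∀ {n} (i k : Fin n) → PC.transpose i i k ≡ k
transpose-self i k with k ≟ i
... | yes k≡i = sym k≡i
... | no  k≢i rewrite dec-false (k ≟ i) k≢i = refl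

module _ {n : ℕ} where

  countNbrs≡∑ : (R : Fin n → Fin n → Bool) (v : Fin n) → countNbrs R v ≡ ∑ (λ w → ⟦ R v w ⟧)
  countNbrs≡∑ R v = sum-map-allFin (λ w → ⟦ R v w ⟧)

  deg≤maxDeg : (G : Graph n) (v : Fin n) → deg G v ≤ maxDeg G
  deg≤maxDeg G v rewrite map-tabulate id (deg G) = ≤-foldr-⊔-tabulate (deg G) v

  relabel : Graph n → Permutation′ n → Graph n
  relabel G π = record
    { adj     = λ a b → adj G (π ⟨$⟩ʳ a) (π ⟨$⟩ʳ b)
    ; adj-sym = λ a b → adj-sym G (π ⟨$⟩ʳ a) (π ⟨$⟩ʳ b)
    ; irrefl  = λ a → irrefl G (π ⟨$⟩ʳ a)
    }

  induced : (H : Graph n) → (Fin n → Bool) → Subgraph H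
  induced H S = record
    { inS   = S
    ; edge  = λ a b → (S a ∧ S b) ∧ adj H a b
    ; e-sym = λ a b → cong₂ _∧_ (∧-comm (S a) (S b)) (adj-sym H a b)
    ; e-sub = λ a b → ∧-conicalʳ _ _
    ; e-inS = λ a b → ∧-conicalˡ _ _ ∘ ∧-conicalˡ _ _
    }

  countNbrs-induced : ∀ (H : Graph n) S {x} → S x ≡ true →
                      countNbrs (edge (induced H S)) x ≡ ∑ (λ j → ⟦ S j ∧ adj H x j ⟧)
  countNbrs-induced H S {x} x∈S rewrite x∈S = countNbrs≡∑ (λ x′ j → S j ∧ adj H x′ j) x

-- Every w ≠ u for which a ~ u once u and w are exchanged is either a itself (if a ~ u) or a
-- neighbour of a other than u; the transposition of u and a matches them with the neighbours of a.
∑-adj-transposed≤deg : ∀ {n} (G : Graph n) {u a : Fin n} → a ≢ u →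
  ∑ (λ w → ⟦ not (does (w ≟ u)) ∧ adj (relabel G (transpose u w)) u a ⟧) ≤ deg G a
∑-adj-transposed≤deg G {u} {a} a≢u = begin
  ∑ f                       ≡⟨ sum-permute f (transpose u a) ⟩
  ∑ (f ∘ PC.transpose u a)  ≤⟨ ∑-mono-≤ (λ w → bound w (w ≟ u) (w ≟ a)) ⟩
  ∑ (λ w → ⟦ adj G a w ⟧)   ≡⟨ countNbrs≡∑ (adj G) a ⟨
  deg G a                   ∎
  where
  open ≤-Reasoning
  f = λ w → ⟦ not (does (w ≟ u)) ∧ adj (relabel G (transpose u w)) u a ⟧
  bound : ∀ w → Dec (w ≡ u) → Dec (w ≡ a) → f (PC.transpose u a w) ≤ ⟦ adj G a w ⟧
  bound w (yes refl) _ = ≤-reflexive (begin-equality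
    f (PC.transpose w a w)  ≡⟨ cong f (transpose-applyˡ w a) ⟩
    f a                     ≡⟨ cong₂ (λ b c → ⟦ not b ∧ c ⟧) (dec-false (a ≟ w) a≢u)
                                 (cong₂ (adj G) (transpose-applyˡ w a) (transpose-applyʳ w a)) ⟩
    ⟦ adj G a w ⟧           ∎)
  bound w (no _) (yes refl) = begin
    f (PC.transpose u w w)  ≡⟨ cong f (transpose-applyʳ u w) ⟩
    f u                     ≡⟨ cong (λ b → ⟦ not b ∧ adj (relabel G (transpose u u)) u w ⟧)
                                    (dec-true (u ≟ u) refl) ⟩
    0                       ≤⟨ z≤n ⟩
    ⟦ adj G w w ⟧           ∎
  bound w (no w≢u) (no w≢a) = begin
    f (PC.transpose u a w)  ≡⟨ cong f (transpose-other w≢u w≢a) ⟩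
    f w                     ≤⟨ ⟦∧⟧-≤ʳ _ _ ⟩
    ⟦ adj G (PC.transpose u w u) (PC.transpose u w a) ⟧
                            ≡⟨ cong ⟦_⟧ (cong₂ (adj G) (transpose-applyˡ u w)
                                                       (transpose-other a≢u (w≢a ∘ sym))) ⟩
    ⟦ adj G w a ⟧           ≡⟨ cong ⟦_⟧ (adj-sym G w a) ⟩
    ⟦ adj G a w ⟧           ∎

∣_∣ : ∀ {n} → (Fin n → Bool) → ℕ
∣ S ∣ = ∑ (⟦_⟧ ∘ S)

_∖_ : ∀ {n} → (Fin n → Bool) → Fin n → (Fin n → Bool)
(S ∖ x) z = S z ∧ not (does (z ≟ x))

∣∖∣<∣∣ : ∀ {n} {S : Fin n → Bool} {x} → S x ≡ true → ∣ S ∖ x ∣ < ∣ S ∣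
∣∖∣<∣∣ {S = S} {x} x∈S = ∑-mono-< (λ z → ⟦∧⟧-≤ˡ (S z) _) x x∉S∖x
  where
  x∉S∖x : ⟦ (S ∖ x) x ⟧ < ⟦ S x ⟧
  x∉S∖x rewrite x∈S | dec-true (x ≟ x) refl = s≤s z≤n

PacksInduced : ∀ {n} → Graph n → Graph n → (Fin n → Bool) → Permutation′ n → Set
PacksInduced G H S σ = ∀ a b → adj G a b ≡ true →
  S (σ ⟨$⟩ʳ a) ≡ true → S (σ ⟨$⟩ʳ b) ≡ true → adj H (σ ⟨$⟩ʳ a) (σ ⟨$⟩ʳ b) ≡ false

packsInduced-relabel : ∀ {n} {G H : Graph n} {S σ} π →
                       PacksInduced (relabel G π) H S σ → PacksInduced G H S (π ⁻¹ ∘ₚ σ)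
packsInduced-relabel {G = G} π packs a b ab = packs (π ⟨$⟩ˡ a) (π ⟨$⟩ˡ b)
  (subst₂ (λ a′ b′ → adj G a′ b′ ≡ true) (sym (inverseʳ π)) (sym (inverseʳ π)) ab)

module Exchange {n} (G H : Graph n) (S : Fin n → Bool) (x : Fin n) (σ : Permutation′ n) where

  u : Fin n
  u = σ ⟨$⟩ˡ x

  σ⟨$⟩ʳ≡x⇒≡u : ∀ {a} → σ ⟨$⟩ʳ a ≡ x → a ≡ u
  σ⟨$⟩ʳ≡x⇒≡u σa≡x = trans (sym (inverseˡ σ)) (cong (σ ⟨$⟩ˡ_) σa≡x)

  G[_] : Fin n → Graph n
  G[ w ] = relabel G (transpose u w)

  N : Fin n → Bool
  N j = S j ∧ adj H x j

  N∘σ⇒≢u : ∀ a → N (σ ⟨$⟩ʳ a) ≡ true → a ≢ u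
  N∘σ⇒≢u a Nσa refl
    with () ← trans (sym (∧-conicalʳ _ _ (subst (λ j → N j ≡ true) (inverseʳ σ) Nσa))) (irrefl H x)

  swapNbr : Fin n → Fin n → Bool
  swapNbr a w = not (does (w ≟ u)) ∧ adj G[ w ] u a

  -- The conflicts of σ with G[ w ] at u (counted only for w ≠ u) and at w.
  bad₁ bad₂ : Fin n → ℕ
  bad₁ w = ∑ (λ a → ⟦ N (σ ⟨$⟩ʳ a) ∧ swapNbr a w ⟧)
  bad₂ w = ∑ (λ b → ⟦ adj G u b ∧ adj H (σ ⟨$⟩ʳ w) (σ ⟨$⟩ʳ b) ⟧)

  ∑bad₁≤sumTop : ∀ {c} → ∑ (⟦_⟧ ∘ N) ≤ c → ∑ bad₁ ≤ sumTop c G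
  ∑bad₁≤sumTop {c} |N|≤c = begin
    ∑ bad₁
      ≡⟨ ∑-comm-⟦∧⟧ (N ∘ (σ ⟨$⟩ʳ_)) swapNbr ⟩
    ∑ (λ a → ⟦ N (σ ⟨$⟩ʳ a) ⟧ * ∑ (λ w → ⟦ swapNbr a w ⟧))
      ≤⟨ ∑-mono-≤ (λ a → ⟦⟧*-monoʳ-≤ (∑-adj-transposed≤deg G ∘ N∘σ⇒≢u a)) ⟩
    ∑ (λ a → ⟦ N (σ ⟨$⟩ʳ a) ⟧ * deg G a)
      ≤⟨ ∑-selected≤sum-largest (deg G) (N ∘ (σ ⟨$⟩ʳ_)) (subst (_≤ c) (sum-permute (⟦_⟧ ∘ N) σ) |N|≤c) ⟩
    sumTop c G
      ∎
    where open ≤-Reasoning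

  ∑bad₂≤sumTop : ∑ bad₂ ≤ sumTop (maxDeg G) H
  ∑bad₂≤sumTop = begin
    ∑ bad₂
      ≡⟨ ∑-comm-⟦∧⟧ (adj G u) (λ b w → adj H (σ ⟨$⟩ʳ w) (σ ⟨$⟩ʳ b)) ⟩
    ∑ (λ b → ⟦ adj G u b ⟧ * ∑ (λ w → ⟦ adj H (σ ⟨$⟩ʳ w) (σ ⟨$⟩ʳ b) ⟧))
      ≡⟨ sum-cong-≗ (λ b → cong (⟦ adj G u b ⟧ *_) (column (σ ⟨$⟩ʳ b))) ⟩
    ∑ (λ b → ⟦ adj G u b ⟧ * deg H (σ ⟨$⟩ʳ b))
      ≡⟨ sum-permute _ (σ ⁻¹) ⟩
    ∑ (λ y → ⟦ adj G u (σ ⟨$⟩ˡ y) ⟧ * deg H (σ ⟨$⟩ʳ (σ ⟨$⟩ˡ y)))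
      ≡⟨ sum-cong-≗ (λ y → cong (λ z → ⟦ adj G u (σ ⟨$⟩ˡ y) ⟧ * deg H z) (inverseʳ σ)) ⟩
    ∑ (λ y → ⟦ adj G u (σ ⟨$⟩ˡ y) ⟧ * deg H y)
      ≤⟨ ∑-selected≤sum-largest (deg H) (adj G u ∘ (σ ⟨$⟩ˡ_)) |N[u]|≤Δ ⟩
    sumTop (maxDeg G) H
      ∎
    where
    open ≤-Reasoning
    column : ∀ y → ∑ (λ w → ⟦ adj H (σ ⟨$⟩ʳ w) y ⟧) ≡ deg H y
    column y = begin-equality
      ∑ (λ w → ⟦ adj H (σ ⟨$⟩ʳ w) y ⟧)  ≡⟨ sum-permute (λ z → ⟦ adj H z y ⟧) σ ⟨
      ∑ (λ z → ⟦ adj H z y ⟧)           ≡⟨ sum-cong-≗ (λ z → cong ⟦_⟧ (adj-sym H z y)) ⟩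
      ∑ (λ z → ⟦ adj H y z ⟧)           ≡⟨ countNbrs≡∑ (adj H) y ⟨
      deg H y                           ∎
    |N[u]|≤Δ : ∑ (λ y → ⟦ adj G u (σ ⟨$⟩ˡ y) ⟧) ≤ maxDeg G
    |N[u]|≤Δ = begin
      ∑ (λ y → ⟦ adj G u (σ ⟨$⟩ˡ y) ⟧)  ≡⟨ sum-permute (λ b → ⟦ adj G u b ⟧) (σ ⁻¹) ⟨
      ∑ (λ b → ⟦ adj G u b ⟧)           ≡⟨ countNbrs≡∑ (adj G) u ⟨
      deg G u                           ≤⟨ deg≤maxDeg G u ⟩
      maxDeg G                          ∎

  module _ (packs : PacksInduced G H (S ∖ x) σ) (w : Fin n) (good : bad₁ w + bad₂ w ≡ 0) where

    no-bad₁ : ∀ a → (N (σ ⟨$⟩ʳ a) ∧ swapNbr a w) ≡ false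
    no-bad₁ a = ⟦⟧≡0⇒≡false (∑≡0⇒≡0 _ (m+n≡0⇒m≡0 (bad₁ w) good) a)

    no-bad₂ : ∀ b → (adj G u b ∧ adj H (σ ⟨$⟩ʳ w) (σ ⟨$⟩ʳ b)) ≡ false
    no-bad₂ b = ⟦⟧≡0⇒≡false (∑≡0⇒≡0 _ (m+n≡0⇒n≡0 (bad₁ w) good) b)

    at-u : ∀ b → adj G[ w ] u b ≡ true → S (σ ⟨$⟩ʳ b) ≡ true → adj H (σ ⟨$⟩ʳ u) (σ ⟨$⟩ʳ b) ≡ false
    at-u b ub Sσb = by-cases (w ≟ u)
      where
      by-cases : Dec (w ≡ u) → adj H (σ ⟨$⟩ʳ u) (σ ⟨$⟩ʳ b) ≡ false
      by-cases (yes refl) = ∧≡false⇒≡falseʳ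
        (subst₂ (λ p q → adj G p q ≡ true) (transpose-self u u) (transpose-self u b) ub) (no-bad₂ b)
      by-cases (no w≢u) = subst (λ z → adj H z (σ ⟨$⟩ʳ b) ≡ false) (sym (inverseʳ σ))
        (∧≡false⇒≡falseʳ Sσb (∧≡false⇒≡falseˡ swapped (no-bad₁ b)))
        where
        swapped : swapNbr b w ≡ true
        swapped rewrite dec-false (w ≟ u) w≢u = ub

    at-w : ∀ b → b ≢ u → adj G[ w ] w b ≡ true → adj H (σ ⟨$⟩ʳ w) (σ ⟨$⟩ʳ b) ≡ false
    at-w b b≢u wb = by-cases (b ≟ w)
      where
      by-cases : Dec (b ≡ w) → adj H (σ ⟨$⟩ʳ w) (σ ⟨$⟩ʳ b) ≡ false
      by-cases (yes refl) = irrefl H (σ ⟨$⟩ʳ b)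
      by-cases (no b≢w)   = ∧≡false⇒≡falseʳ
        (subst₂ (λ p q → adj G p q ≡ true) (transpose-applyʳ u w) (transpose-other b≢u b≢w) wb) (no-bad₂ b)

    elsewhere : ∀ {a b} → a ≢ u → a ≢ w → b ≢ u → b ≢ w → adj G[ w ] a b ≡ true →
                S (σ ⟨$⟩ʳ a) ≡ true → S (σ ⟨$⟩ʳ b) ≡ true → adj H (σ ⟨$⟩ʳ a) (σ ⟨$⟩ʳ b) ≡ false
    elsewhere a≢u a≢w b≢u b≢w ab Sσa Sσb = packs _ _
      (subst₂ (λ p q → adj G p q ≡ true) (transpose-other a≢u a≢w) (transpose-other b≢u b≢w) ab)
      (∈S∖x a≢u Sσa) (∈S∖x b≢u Sσb)
      where
      ∈S∖x : ∀ {c} → c ≢ u → S (σ ⟨$⟩ʳ c) ≡ true → (S ∖ x) (σ ⟨$⟩ʳ c) ≡ true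
      ∈S∖x {c} c≢u Sσc rewrite Sσc | dec-false (σ ⟨$⟩ʳ c ≟ x) (c≢u ∘ σ⟨$⟩ʳ≡x⇒≡u) = refl

    packs-G[w] : PacksInduced G[ w ] H S σ
    packs-G[w] a b ab Sσa Sσb = cases (a ≟ u) (b ≟ u) (a ≟ w) (b ≟ w)
      where
      flipH : ∀ {p q} → adj H p q ≡ false → adj H q p ≡ false
      flipH {p} {q} = trans (adj-sym H q p)
      cases : Dec (a ≡ u) → Dec (b ≡ u) → Dec (a ≡ w) → Dec (b ≡ w) →
              adj H (σ ⟨$⟩ʳ a) (σ ⟨$⟩ʳ b) ≡ false
      cases (yes refl) _          _          _          = at-u b ab Sσb
      cases (no _)     (yes refl) _          _          = flipH (at-u a (trans (adj-sym G[ w ] u a) ab) Sσa)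
      cases (no _)     (no b≢u)   (yes refl) _          = at-w b b≢u ab
      cases (no a≢u)   (no _)     (no _)     (yes refl) = flipH (at-w a a≢u (trans (adj-sym G[ w ] w a) ab))
      cases (no a≢u)   (no b≢u)   (no a≢w)   (no b≢w)   = elsewhere a≢u a≢w b≢u b≢w ab Sσa Sσb

module _ {n c : ℕ} {G H : Graph n} (small : sumTop (maxDeg G) H + sumTop c G < n) where

  extend : ∀ {S x σ} → ∑ (λ j → ⟦ S j ∧ adj H x j ⟧) ≤ c →
           PacksInduced G H (S ∖ x) σ → ∃ (PacksInduced G H S)
  extend {S} {x} {σ} |N|≤c packs = exchange (∑<n⇒∃≡0 (λ w → bad₁ w + bad₂ w) fewConflicts)
    where
    open Exchange G H S x σ
    fewConflicts : ∑ (λ w → bad₁ w + bad₂ w) < n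
    fewConflicts = begin-strict
      ∑ (λ w → bad₁ w + bad₂ w)         ≡⟨ ∑-distrib-+ bad₁ bad₂ ⟩
      ∑ bad₁ + ∑ bad₂                   ≤⟨ +-mono-≤ (∑bad₁≤sumTop |N|≤c) ∑bad₂≤sumTop ⟩
      sumTop c G + sumTop (maxDeg G) H  ≡⟨ +-comm (sumTop c G) _ ⟩
      sumTop (maxDeg G) H + sumTop c G  <⟨ small ⟩
      n                                 ∎
      where open ≤-Reasoning
    exchange : (∃ λ w → bad₁ w + bad₂ w ≡ 0) → ∃ (PacksInduced G H S)
    exchange (w , good) = transpose u w ⁻¹ ∘ₚ σ
                        , packsInduced-relabel {G = G} {H} {S} {σ} (transpose u w) (packs-G[w] packs w good)

  packsInduced : Degenerate c H → ∀ S → ∃ (PacksInduced G H S)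
  packsInduced degenerate = All.wfRec (On.wellFounded ∣_∣ <-wellFounded) _ _ step
    where
    step : ∀ S → (∀ {S′} → ∣ S′ ∣ < ∣ S ∣ → ∃ (PacksInduced G H S′)) → ∃ (PacksInduced G H S)
    step S rec with any? (λ v → S v Bool.≟ true)
    ... | no empty = idₚ , λ a _ _ Sσa _ → ⊥-elim (empty (_ , Sσa))
    ... | yes nonempty with degenerate (induced H S) nonempty
    ...   | x , x∈S , deg≤c =
      let σ , packs = rec {S ∖ x} (∣∖∣<∣∣ {S = S} x∈S)
      in  extend {S} {x} {σ} (subst (_≤ c) (countNbrs-induced H S x∈S) deg≤c) packs

theorem1p6 : (n c : ℕ) (G H : Graph n) → Degenerate c H →
    sumTop (maxDeg G) H + sumTop c G < n → Pack G H
theorem1p6 n c G H degenerate small with packsInduced {G = G} {H} small degenerate (λ _ → true)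
... | σ , packs = ↔⇒⤖ σ , λ a b ab → packs a b ab refl refl
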